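{- Let $E=\mathbb{N}\times\mathbb{N}$ (with $\mathbb{N}=\{1,2,3,\dots\}$), where the element $(i,j)\in E$ is said to lie in column $i$ and row $j$. Let $\mathcal{L}_1$ be the family of all $A\subseteq E$ such that for every $n\in\mathbb{N}$, the set $A$ has at most $n$ elements in rows $1,\dots,n$. For an infinite set $A\subseteq E$, say that column $l$ is dominant in $A$ if all but finitely many elements of $A$ lie in column $l$. Let $\mathcal{L}\subseteq 2^E$ consist of exactly the following sets: (i) every finite $A\in\mathcal{L}_1$; (ii) every infinite $A\in\mathcal{L}_1$ that has no dominant column; (iii) every set of the form $A_1\setminus X$, where $A_1\in\mathcal{L}_1$ is infinite with dominant column $l$, and $X\subseteq A_1$ satisfies $|X|\geq l$. Then $M=(E,\mathcal{L})$ is a matroid which is nearly finitary, but $M$ is not $n$-nearly finitary for any $n\in\mathbb{N}$.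
   Context: A matroid is a pair $(E,\mathcal{L})$ with $E$ a (possibly infinite) set and $\mathcal{L}\subseteq 2^E$ satisfying: (I1) $\emptyset\in\mathcal{L}$; (I2) if $B\in\mathcal{L}$ and $A\subseteq B$ then $A\in\mathcal{L}$; (I3) if $B$ is a maximal element of $\mathcal{L}$ and $A$ is a non-maximal element of $\mathcal{L}$, then there is $b\in B\setminus A$ with $A\cup\{b\}\in\mathcal{L}$; (I4) if $A\in\mathcal{L}$ and $A\subseteq X\subseteq E$, then $\{S\in\mathcal{L}: A\subseteq S\subseteq X\}$ has a maximal element (with respect to inclusion). Elements of $\mathcal{L}$ are independent sets; maximal ones are bases. The finitarization of a matroid $M=(E,\mathcal{L})$ is the matroid $M^{\mathrm{fin}}=(E,\mathcal{L}^{\mathrm{fin}})$ where $\mathcal{L}^{\mathrm{fin}}$ consists of all $S\subseteq E$ all of whose finite subsets lie in $\mathcal{L}$. A matroid $M$ is nearly finitary if whenever a base $F$ of $M^{\mathrm{fin}}$ contains a base $B$ of $M$, the set $F\setminus B$ is finite. For $k\in\mathbb{N}$, $M$ is $k$-nearly finitary if whenever a base $F$ of $M^{\mathrm{fin}}$ contains a base $B$ of $M$, $|F\setminus B|\leq k$. -}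

module Defs where

open import Data.Nat using (ℕ; zero; suc; _≤_; _<_)
open import Data.Product using (Σ; ∃; _×_; _,_; proj₁; proj₂)
open import Data.Sum using (_⊎_)
open import Data.Empty using (⊥)
open import Data.List using (List; length)
open import Data.List.Membership.Propositional using (_∈_)
open import Data.List.Relation.Unary.All using (All)
open import Data.List.Relation.Unary.Unique.Propositional using (Unique)
open import Relation.Nullary using (¬_)
open import Relation.Binary.PropositionalEquality using (_≡_)

LEM : Set₁
LEM = (P : Set) → P ⊎ ¬ P

Subset : Set → Set₁
Subset E = E → Set

module _ {E : Set} where

  ∅ : Subset E
  ∅ _ = ⊥

  _⊆_ : Subset E → Subset E → Set
  A ⊆ B = ∀ x → A x → B x

  _∖_ : Subset E → Subset E → Subset E
  (A ∖ B) x = A x × ¬ B x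

  _∪_ : Subset E → Subset E → Subset E
  (A ∪ B) x = A x ⊎ B x

  ｛_｝ : E → Subset E
  ｛ b ｝ x = x ≡ b

  Finite : Subset E → Set
  Finite A = Σ (List E) λ xs → ∀ x → A x → x ∈ xs

  Infinite : Subset E → Set
  Infinite A = ¬ Finite A

  AtMost : ℕ → Subset E → Set
  AtMost n A = (xs : List E) → Unique xs → All A xs → length xs ≤ n

  AtLeast : ℕ → Subset E → Set
  AtLeast n A = Σ (List E) λ xs → Unique xs × All A xs × n ≤ length xs

  Maximal : (Subset E → Set₁) → Subset E → Set₁
  Maximal P S = P S × (∀ T → P T → S ⊆ T → T ⊆ S)

  record IsMatroid (I : Subset E → Set₁) : Set₁ where
    field
      I1 : I ∅
      I2 : ∀ A B → I B → A ⊆ B → I A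
      I3 : ∀ A B → Maximal I B → I A → ¬ Maximal I A →
           Σ E λ b → B b × ¬ A b × I (A ∪ ｛ b ｝)
      I4 : ∀ A X → I A → A ⊆ X →
           Σ (Subset E) λ S → Maximal (λ T → I T × A ⊆ T × T ⊆ X) S

  Fin-ify : (Subset E → Set₁) → Subset E → Set₁
  Fin-ify I S = ∀ F → F ⊆ S → Finite F → I F

  Base : (Subset E → Set₁) → Subset E → Set₁
  Base I B = Maximal I B

  BaseFin : (Subset E → Set₁) → Subset E → Set₁
  BaseFin I F = Maximal (Fin-ify I) F

  NearlyFinitary : (Subset E → Set₁) → Set₁
  NearlyFinitary I = ∀ F B → BaseFin I F → Base I B → B ⊆ F → Finite (F ∖ B)

  KNearlyFinitary : ℕ → (Subset E → Set₁) → Set₁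
  KNearlyFinitary k I = ∀ F B → BaseFin I F → Base I B → B ⊆ F → AtMost k (F ∖ B)

-- The example.  We use 0-based indices: E = ℕ × ℕ, (i , j) lies in
-- column i and row j; paper's column/row c corresponds to our c - 1.

E : Set
E = ℕ × ℕ

col : E → ℕ
col = proj₁

row : E → ℕ
row = proj₂

L₁ : Subset E → Set
L₁ A = (n : ℕ) → AtMost n (λ x → A x × row x < n)

Dominant : ℕ → Subset E → Set
Dominant l A = Infinite A × Finite (λ x → A x × ¬ (col x ≡ l))

-- The family 𝓛.  Paper's condition |X| ≥ l (l 1-based) becomes
-- |X| ≥ suc l with our 0-based column index l.
𝓛 : Subset E → Set₁
𝓛 A =
    (Finite A × L₁ A)
  ⊎ (Infinite A × L₁ A × (∀ l → ¬ Dominant l A))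
  ⊎ (Σ (Subset E) λ A₁ → Σ ℕ λ l → Σ (Subset E) λ X →
       L₁ A₁ × Dominant l A₁ × X ⊆ A₁ × AtLeast (suc l) X ×
       (∀ x → (A x → (A₁ ∖ X) x) × ((A₁ ∖ X) x → A x)))

{-# OPTIONS --safe #-}
-- Say A has slack k at n if A has at most n − k cells in the rows below n. Then A ∈ 𝓛 iff
-- A ∈ 𝓛₁ and, if column l is dominant in A, A has slack l + 1 at all large n: deleting the
-- l + 1 cells X creates this slack, and conversely the slack leaves room for l + 1 new cells
-- in a fresh column. This description is closed under subsets, and adding one cell above the
-- last row n where A is tight (has exactly n cells below n) preserves it, which gives (I3):
-- if a base B had no such cell outside A, then B ∪ {y} would be independent for the y that
-- extends A. For (I4), saturate A greedily inside X with respect to the finitary 𝓛₁, and pass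
-- to an independent S ⊇ A missing only finitely many cells Y of the saturation (if column l
-- dominates, delete l + 1 cells outside A). Every 𝓛₁-set between S and X exceeds S by at most
-- |Y| cells, so an independent extension of S inside X with the most cells is maximal.
-- A base F of the finitarization is in 𝓛₁, and deleting l + 1 cells of a dominant column l of F
-- gives a set in 𝓛, so a base inside F misses at most l + 1 cells of F. For column c without
-- its lowest c + 1 cells, inside the finitary base column c, that bound is attained.

module Submission where

open import Defs
open import Data.Nat using (ℕ; zero; suc; _+_; _≤_; _<_; _⊔_; z≤n; s≤s)
open import Data.Nat.Properties
open import Data.Product using (Σ; ∃; _×_; _,_; proj₁; proj₂)
open import Data.Product.Properties using (≡-dec)
open import Data.Sum using (_⊎_; inj₁; inj₂; [_,_])
import Data.Sum as Sum
open import Data.Empty using (⊥-elim)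
open import Data.List using (List; []; _∷_; length; _++_; map; upTo; filter)
open import Data.List.Properties using (length-++; length-map; length-upTo; filter-notAll)
open import Data.List.Extrema.Nat using (max; xs≤max)
open import Data.List.Membership.Propositional using (_∈_; _∉_)
open import Data.List.Membership.Propositional.Properties
  using (∈-map⁻; ∈-map⁺; ∈-upTo⁺; ∈-upTo⁻; ∈-filter⁻; ∈-filter⁺; ∈-++⁺ˡ; ∈-++⁺ʳ)
open import Data.List.Relation.Unary.Any using (here; there)
import Data.List.Relation.Unary.Any as Any
open import Data.List.Relation.Unary.All using (All; []; _∷_)
import Data.List.Relation.Unary.All as All
import Data.List.Relation.Unary.All.Properties as All
open import Data.List.Relation.Unary.AllPairs using ([]; _∷_)
open import Data.List.Relation.Unary.Unique.Propositional using (Unique)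
import Data.List.Relation.Unary.Unique.Propositional.Properties as Unique
open import Relation.Nullary using (¬_; yes; no; ¬?)
open import Relation.Unary using (Decidable)
open import Relation.Unary.Properties using (∁?)
open import Relation.Binary using (DecidableEquality)
open import Relation.Binary.PropositionalEquality using (_≡_; _≢_; refl; sym; trans; cong; subst)

module _ {A : Set} where

  length-filter-∁ : {P : A → Set} (P? : Decidable P) (xs : List A) →
                    length (filter P? xs) + length (filter (∁? P?) xs) ≡ length xs
  length-filter-∁ P? [] = refl
  length-filter-∁ P? (x ∷ xs) with P? x
  ... | yes _ = cong suc (length-filter-∁ P? xs)
  ... | no _ = trans (+-suc _ _) (cong suc (length-filter-∁ P? xs))

  Unique⊆⇒length≤ : DecidableEquality A → {xs ys : List A} → Unique xs →
                     (∀ {z} → z ∈ xs → z ∈ ys) → length xs ≤ length ys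
  Unique⊆⇒length≤ _≟_ {[]} _ _ = z≤n
  Unique⊆⇒length≤ _≟_ {x ∷ xs} {ys} (x∉xs ∷ u) xs⊆ys =
    ≤-trans (s≤s (Unique⊆⇒length≤ _≟_ u xs⊆ys-x))
            (filter-notAll (λ z → ¬? (z ≟ x)) ys (Any.map (λ x≡z z≢x → z≢x (sym x≡z)) (xs⊆ys (here refl))))
    where
    xs⊆ys-x : ∀ {z} → z ∈ xs → z ∈ filter (λ z → ¬? (z ≟ x)) ys
    xs⊆ys-x z∈xs = ∈-filter⁺ _ (xs⊆ys (there z∈xs)) λ z≡x → All.lookup x∉xs z∈xs (sym z≡x)

  Unique-++ : {P Q : A → Set} {xs ys : List A} → Unique xs → Unique ys → All P xs → All Q ys →
              (∀ {x} → P x → ¬ Q x) → Unique (xs ++ ys)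
  Unique-++ ux uy pxs qys P∩Q≡∅ =
    Unique.++⁺ ux uy λ (v∈xs , v∈ys) → P∩Q≡∅ (All.lookup pxs v∈xs) (All.lookup qys v∈ys)

  list-bounded : (f : A → ℕ) (xs : List A) → ∃ λ m → All (λ x → f x < m) xs
  list-bounded f xs = suc (max 0 (map f xs)) , All.map s≤s (All.map⁻ (xs≤max 0 (map f xs)))

  finite⇒bounded : (f : A → ℕ) {P : Subset A} → Finite P → ∃ λ m → ∀ x → P x → f x < m
  finite⇒bounded f (xs , P⊆xs) =
    let m , xs<m = list-bounded f xs in m , λ x px → All.lookup xs<m (P⊆xs x px)

  Finite-⊆ : {P Q : Subset A} → P ⊆ Q → Finite Q → Finite P
  Finite-⊆ P⊆Q (xs , Q⊆xs) = xs , λ x px → Q⊆xs x (P⊆Q x px)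

  Finite-∪ : {P Q : Subset A} → Finite P → Finite Q → Finite (P ∪ Q)
  Finite-∪ (xs , P⊆xs) (ys , Q⊆ys) = xs ++ ys , λ where
    x (inj₁ px) → ∈-++⁺ˡ (P⊆xs x px)
    x (inj₂ qx) → ∈-++⁺ʳ xs (Q⊆ys x qx)

  Finite-list : (xs : List A) → Finite (_∈ xs)
  Finite-list xs = xs , λ _ x∈xs → x∈xs

  Infinite-∪⁻ : {P F : Subset A} → Finite F → Infinite (P ∪ F) → Infinite P
  Infinite-∪⁻ finF infP∪F finP = infP∪F (Finite-∪ finP finF)

  AtLeast-⊆ : {k : ℕ} {P Q : Subset A} → P ⊆ Q → AtLeast k P → AtLeast k Q
  AtLeast-⊆ P⊆Q (xs , u , pxs , k≤) = xs , u , All.map (P⊆Q _) pxs , k≤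

  Finite-｛｝ : {b : A} → Finite ｛ b ｝
  Finite-｛｝ {b} = b ∷ [] , λ _ x≡b → here x≡b

  ∪｛｝-⊆ : {P T : Subset A} {x : A} → P ⊆ T → T x → (P ∪ ｛ x ｝) ⊆ T
  ∪｛｝-⊆ P⊆T tx z (inj₁ pz) = P⊆T z pz
  ∪｛｝-⊆ P⊆T tx z (inj₂ refl) = tx

common-level : {A : Set} {G : A → Set} {Q : ℕ → Set} (f : A → ℕ) → Q 0 → (zs : List A) →
               (∀ {z} → z ∈ zs → G z ⊎ ∃ λ n → Q n × f z < n) →
               ∃ λ n → Q n × (∀ {z} → z ∈ zs → G z ⊎ f z < n)
common-level f q₀ [] _ = 0 , q₀ , λ ()
common-level f q₀ (z ∷ zs) levels with common-level f q₀ zs (λ z∈ → levels (there z∈)) | levels (here refl)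
... | n , qn , below | inj₁ gz = n , qn , λ { (here refl) → inj₁ gz ; (there z∈) → below z∈ }
... | n , qn , below | inj₂ (m , qm , z<m) with n ≤? m
...   | yes n≤m = m , qm , λ { (here refl) → inj₂ z<m
                            ; (there z∈) → Sum.map₂ (λ r → <-≤-trans r n≤m) (below z∈) }
...   | no n≰m = n , qn , λ { (here refl) → inj₂ (<-trans z<m (≰⇒> n≰m)) ; (there z∈) → below z∈ }

_≟E_ : DecidableEquality E
_≟E_ = ≡-dec _≟_ _≟_

open import Data.List.Membership.DecPropositional _≟E_ using (_∈?_)

rows-unbounded⇒Infinite : {P : Subset E} → (∀ r → ∃ λ x → P x × r ≤ row x) → Infinite P
rows-unbounded⇒Infinite unbounded finP with finite⇒bounded row finP
... | m , below-m with unbounded m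
... | x , px , m≤x = <⇒≱ (below-m x px) m≤x

segment : ℕ → ℕ → ℕ → List E
segment c r k = map (λ i → c , r + i) (upTo k)

module _ {c r k : ℕ} where

  length-segment : length (segment c r k) ≡ k
  length-segment = trans (length-map _ (upTo k)) (length-upTo k)

  segment-unique : Unique (segment c r k)
  segment-unique = Unique.map⁺ (λ e → +-cancelˡ-≡ r _ _ (cong row e)) (Unique.upTo⁺ k)

  ∈-segment⁻ : {x : E} → x ∈ segment c r k → col x ≡ c × r ≤ row x × row x < r + k
  ∈-segment⁻ x∈ with ∈-map⁻ _ x∈
  ... | i , i∈ , refl = refl , m≤m+n r i , +-monoʳ-< r (∈-upTo⁻ i∈)

  AtLeast-segment : {P : Subset E} → All P (segment c r k) → AtLeast k P
  AtLeast-segment all = segment c r k , segment-unique , all , ≤-reflexive (sym length-segment)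

∈-segment⁺ : {c k : ℕ} {x : E} → col x ≡ c → row x < k → x ∈ segment c 0 k
∈-segment⁺ refl j<k = ∈-map⁺ _ (∈-upTo⁺ j<k)

next : E → E
next (i , zero) = zero , suc i
next (i , suc j) = suc i , j

-- Cantor's enumeration of E along the antidiagonals
cell : ℕ → E
cell zero = 0 , 0
cell (suc k) = next (cell k)

cell-walk : ∀ m {i j k} → cell k ≡ (i , m + j) → cell (m + k) ≡ (m + i , j)
cell-walk zero e = e
cell-walk (suc m) {i} {j} e = cong next (cell-walk m (trans e (cong (i ,_) (sym (+-suc m j)))))

cell-diagonal : ∀ d → ∃ λ k → cell k ≡ (0 , d)
cell-diagonal zero = 0 , refl
cell-diagonal (suc d) with cell-diagonal d
... | k , e = suc (d + k) , trans (cong next (cell-walk d (trans e (cong (0 ,_) (sym (+-identityʳ d))))))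
                                  (cong (λ t → 0 , suc t) (+-identityʳ d))

cell-surjective : ∀ x → ∃ λ k → cell k ≡ x
cell-surjective (i , j) with cell-diagonal (i + j)
... | k , e = i + k , trans (cell-walk i e) (cong (_, j) (+-identityʳ i))

_↓_ : Subset E → ℕ → Subset E
(A ↓ n) x = A x × row x < n

↓-⊆ : {A B : Subset E} {n : ℕ} → A ⊆ B → (A ↓ n) ⊆ (B ↓ n)
↓-⊆ A⊆B x (ax , r) = A⊆B x ax , r

Slack : ℕ → ℕ → Subset E → Set
Slack k n P = (zs : List E) → Unique zs → All P zs → k + length zs ≤ n

Tight : Subset E → ℕ → Set
Tight A n = AtLeast n (A ↓ n)

EventualSlack : ℕ → Subset E → Set
EventualSlack k A = ∃ λ R → ∀ n → R ≤ n → Slack k n (A ↓ n)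

module _ {k n : ℕ} {P Q : Subset E} where

  Slack-⊆ : P ⊆ Q → Slack k n Q → Slack k n P
  Slack-⊆ P⊆Q slack zs u pzs = slack zs u (All.map (P⊆Q _) pzs)

  Slack-∖ : {xs : List E} → Slack k n Q → P ⊆ Q → Unique xs → All (Q ∖ P) xs →
            Slack (k + length xs) n P
  Slack-∖ {xs} slack P⊆Q uxs xs⊆Q∖P zs u pzs = begin
    k + length xs + length zs   ≡⟨ +-assoc k (length xs) (length zs) ⟩
    k + (length xs + length zs) ≡⟨ cong (k +_) (+-comm (length xs) (length zs)) ⟩
    k + (length zs + length xs) ≡⟨ cong (k +_) (sym (length-++ zs)) ⟩
    k + length (zs ++ xs)       ≤⟨ slack (zs ++ xs) zs++xs-unique zs++xs⊆Q ⟩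
    n                           ∎
    where
    open ≤-Reasoning
    zs++xs-unique = Unique-++ u uxs pzs xs⊆Q∖P λ px (_ , ¬px) → ¬px px
    zs++xs⊆Q = All.++⁺ (All.map (P⊆Q _) pzs) (All.map proj₁ xs⊆Q∖P)

module _ {n : ℕ} {P : Subset E} where

  Slack-≤ : {j k : ℕ} → j ≤ k → Slack k n P → Slack j n P
  Slack-≤ j≤k slack zs u pzs = ≤-trans (+-monoˡ-≤ (length zs) j≤k) (slack zs u pzs)

  AtLeast-Slack : {m k : ℕ} → AtLeast m P → Slack k n P → k + m ≤ n
  AtLeast-Slack {k = k} (xs , u , pxs , m≤) slack = ≤-trans (+-monoʳ-≤ k m≤) (slack xs u pxs)

  ¬AtLeast⇒Slack1 : ¬ AtLeast n P → Slack 1 n P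
  ¬AtLeast⇒Slack1 ¬atLeast zs u pzs = ≰⇒> λ n≤ → ¬atLeast (zs , u , pzs , n≤)

  Slack-insert : {k : ℕ} (ys : List E) → Slack (length ys + k) n P → Slack k n (P ∪ (_∈ ys))
  Slack-insert {k} ys slack zs u pzs = begin
    k + length zs                               ≡⟨ cong (k +_) (sym (length-filter-∁ ∈ys? zs)) ⟩
    k + (length inside + length outside)         ≤⟨ +-monoʳ-≤ k (+-monoˡ-≤ (length outside) inside≤ys) ⟩
    k + (length ys + length outside)             ≡⟨ sym (+-assoc k _ _) ⟩
    k + length ys + length outside               ≡⟨ cong (_+ length outside) (+-comm k (length ys)) ⟩
    length ys + k + length outside               ≤⟨ slack outside (Unique.filter⁺ (∁? ∈ys?) u) outside⊆P ⟩
    n                                           ∎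
    where
    open ≤-Reasoning
    ∈ys? : Decidable (_∈ ys)
    ∈ys? z = z ∈? ys
    inside = filter ∈ys? zs
    outside = filter (∁? ∈ys?) zs
    inside≤ys : length inside ≤ length ys
    inside≤ys = Unique⊆⇒length≤ _≟E_ (Unique.filter⁺ ∈ys? u) λ z∈ → proj₂ (∈-filter⁻ ∈ys? {xs = zs} z∈)
    outside⊆P : All P outside
    outside⊆P = All.tabulate λ z∈ → let z∈zs , z∉ys = ∈-filter⁻ (∁? ∈ys?) {xs = zs} z∈ in
      [ (λ pz → pz) , (λ z∈ys → ⊥-elim (z∉ys z∈ys)) ] (All.lookup pzs z∈zs)

L₁-⊆ : {A B : Subset E} → A ⊆ B → L₁ B → L₁ A
L₁-⊆ A⊆B L₁B n = Slack-⊆ (↓-⊆ A⊆B) (L₁B n)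

L₁-∅ : L₁ ∅
L₁-∅ n [] _ _ = z≤n
L₁-∅ n (_ ∷ _) _ ((() , _) ∷ _)

module _ {k : ℕ} {A B : Subset E} where

  EventualSlack-⊆ : A ⊆ B → EventualSlack k B → EventualSlack k A
  EventualSlack-⊆ A⊆B (R , slack) = R , λ n R≤n → Slack-⊆ (↓-⊆ A⊆B) (slack n R≤n)

  EventualSlack-∖ : {j : ℕ} → EventualSlack j B → A ⊆ B → AtLeast k (B ∖ A) → EventualSlack (j + k) A
  EventualSlack-∖ {j} (R , slack) A⊆B (xs , u , xs⊆B∖A , k≤) = R ⊔ m , λ n R⊔m≤n →
    Slack-≤ (+-monoʳ-≤ j k≤)
      (Slack-∖ (slack n (≤-trans (m≤m⊔n R m) R⊔m≤n)) (↓-⊆ A⊆B) u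
        (All.zipWith (below (≤-trans (m≤n⊔m R m) R⊔m≤n)) (xs⊆B∖A , xs<m)))
    where
    m = proj₁ (list-bounded row xs)
    xs<m = proj₂ (list-bounded row xs)
    below : ∀ {n x} → m ≤ n → (B ∖ A) x × row x < m → ((B ↓ n) ∖ (A ↓ n)) x
    below m≤n ((bx , x∉A) , x<m) = (bx , <-≤-trans x<m m≤n) , λ (ax , _) → x∉A ax

L₁⇒EventualSlack : {A : Subset E} → L₁ A → EventualSlack 0 A
L₁⇒EventualSlack L₁A = 0 , λ n _ → L₁A n

EventualSlack-insert : {k : ℕ} {A : Subset E} {b : E} → EventualSlack (k + 1) A → EventualSlack k (A ∪ ｛ b ｝)
EventualSlack-insert {k} {b = b} (R , slack) = R , λ n R≤n →
  Slack-⊆ (λ { x (inj₁ ax , r) → inj₁ (ax , r) ; x (inj₂ refl , _) → inj₂ (here refl) })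
          (Slack-insert (b ∷ []) (Slack-≤ (≤-reflexive (+-comm 1 k)) (slack n R≤n)))

Dominated : ℕ → Subset E → Subset E → Set
Dominated n₀ P Q = AtMost n₀ (P ↓ n₀) × Tight Q n₀ × (∀ x → P x → n₀ ≤ row x → Q x)

module _ {n₀ : ℕ} {P Q : Subset E} where

  Slack-transfer : {k n : ℕ} → Dominated n₀ P Q → n₀ ≤ n → Slack k n (Q ↓ n) → Slack k n (P ↓ n)
  Slack-transfer {k} {n} (lowP , (ts , uts , tsQ , n₀≤ts) , highP⊆Q) n₀≤n slack zs u pzs = begin
    k + length zs                    ≡⟨ cong (k +_) (sym (length-filter-∁ low? zs)) ⟩
    k + (length low + length high)   ≤⟨ +-monoʳ-≤ k (+-monoˡ-≤ (length high) (≤-trans low≤n₀ n₀≤ts)) ⟩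
    k + (length ts + length high)    ≡⟨ cong (k +_) (sym (length-++ ts)) ⟩
    k + length (ts ++ high)          ≤⟨ slack (ts ++ high) ts++high-unique (All.++⁺ tsQ↓n highQ↓n) ⟩
    n                                ∎
    where
    open ≤-Reasoning
    low? : Decidable (λ x → row x < n₀)
    low? x = row x <? n₀
    low = filter low? zs
    high = filter (∁? low?) zs
    low≤n₀ : length low ≤ n₀
    low≤n₀ = lowP low (Unique.filter⁺ low? u)
      (All.tabulate λ x∈ → let x∈zs , r = ∈-filter⁻ low? {xs = zs} x∈ in proj₁ (All.lookup pzs x∈zs) , r)
    tsQ↓n : All (Q ↓ n) ts
    tsQ↓n = All.map (λ (qx , r) → qx , <-≤-trans r n₀≤n) tsQ
    highQ↓n : All (Q ↓ n) high
    highQ↓n = All.tabulate λ x∈ →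
      let x∈zs , ¬r = ∈-filter⁻ (∁? low?) {xs = zs} x∈
          px , r = All.lookup pzs x∈zs
      in highP⊆Q _ px (≮⇒≥ ¬r) , r
    ts++high-unique = Unique-++ uts (Unique.filter⁺ (∁? low?) u) (All.map proj₂ tsQ) (All.all-filter (∁? low?) zs)
                                λ r ¬r → ¬r r

  EventualSlack-transfer : {k : ℕ} → Dominated n₀ P Q → EventualSlack k Q → EventualSlack k P
  EventualSlack-transfer dom (R , slack) = R ⊔ n₀ , λ n R⊔n₀≤n →
    Slack-transfer dom (≤-trans (m≤n⊔m R n₀) R⊔n₀≤n) (slack n (≤-trans (m≤m⊔n R n₀) R⊔n₀≤n))

  Dominated-∪ : {F : Subset E} → Dominated n₀ P Q → F ⊆ Q → (∀ x → F x → n₀ ≤ row x) →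
                Dominated n₀ (P ∪ F) Q
  Dominated-∪ {F} (lowP , tightQ , highP⊆Q) F⊆Q F-high = Slack-⊆ lowP∪F⊆P lowP , tightQ , highP∪F⊆Q
    where
    lowP∪F⊆P : ((P ∪ F) ↓ n₀) ⊆ (P ↓ n₀)
    lowP∪F⊆P x (inj₁ px , r) = px , r
    lowP∪F⊆P x (inj₂ fx , r) = ⊥-elim (<⇒≱ r (F-high x fx))
    highP∪F⊆Q : ∀ x → (P ∪ F) x → n₀ ≤ row x → Q x
    highP∪F⊆Q x (inj₁ px) = highP⊆Q x px
    highP∪F⊆Q x (inj₂ fx) _ = F⊆Q x fx

-- Below n, S is full and T contains S outside Y, so Z can only take the places of S ∩ Y.
tight-exchange : {S T Z : Subset E} {n : ℕ} (Y : List E) → Tight S n → L₁ T → Z ⊆ T →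
                 (∀ x → S x → x ∉ Y → T x × ¬ Z x) → AtMost (length (filter (λ y → row y <? n) Y)) (Z ↓ n)
tight-exchange {S} {T} {Z} {n} Y (ts , uts , tsS , n≤ts) L₁T Z⊆T S∖Y⊆T∖Z zs u zsZ =
  ≤-trans zs≤inside (Unique⊆⇒length≤ _≟E_ (Unique.filter⁺ ∈Y? uts) inside⊆Y↓n)
  where
  open ≤-Reasoning
  ∈Y? : Decidable (_∈ Y)
  ∈Y? x = x ∈? Y
  inside = filter ∈Y? ts
  outside = filter (∁? ∈Y?) ts
  outside⊆T∖Z : All (λ x → (T ↓ n) x × ¬ Z x) outside
  outside⊆T∖Z = All.tabulate λ x∈ →
    let x∈ts , x∉Y = ∈-filter⁻ (∁? ∈Y?) {xs = ts} x∈ in lift (All.lookup tsS x∈ts) x∉Y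
    where
    lift : ∀ {x} → (S ↓ n) x → x ∉ Y → (T ↓ n) x × ¬ Z x
    lift (sx , r) x∉Y = let tx , x∉Z = S∖Y⊆T∖Z _ sx x∉Y in (tx , r) , x∉Z
  outside++zs-unique = Unique-++ (Unique.filter⁺ (∁? ∈Y?) uts) u (All.map proj₂ outside⊆T∖Z) (All.map proj₁ zsZ)
                                 λ x∉Z x∈Z → x∉Z x∈Z
  outside++zs⊆T↓n = All.++⁺ (All.map proj₁ outside⊆T∖Z) (All.map (λ (zx , r) → Z⊆T _ zx , r) zsZ)
  zs≤inside : length zs ≤ length inside
  zs≤inside = +-cancelˡ-≤ (length outside) _ _ (begin
    length outside + length zs      ≡⟨ sym (length-++ outside) ⟩
    length (outside ++ zs)          ≤⟨ L₁T n (outside ++ zs) outside++zs-unique outside++zs⊆T↓n ⟩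
    n                               ≤⟨ n≤ts ⟩
    length ts                       ≡⟨ sym (length-filter-∁ ∈Y? ts) ⟩
    length inside + length outside  ≡⟨ +-comm (length inside) (length outside) ⟩
    length outside + length inside  ∎)
  inside⊆Y↓n : ∀ {x} → x ∈ inside → x ∈ filter (λ y → row y <? n) Y
  inside⊆Y↓n x∈ = let x∈ts , x∈Y = ∈-filter⁻ ∈Y? {xs = ts} x∈ in
    ∈-filter⁺ (λ y → row y <? n) x∈Y (proj₂ (All.lookup tsS x∈ts))

module _ {l : ℕ} where

  Dominant-⊆ : {A B : Subset E} → A ⊆ B → Infinite A → Dominant l B → Dominant l A
  Dominant-⊆ A⊆B infA (_ , finB) = infA , Finite-⊆ (λ x (ax , c≢l) → A⊆B x ax , c≢l) finB

  Dominant-∪ : {A F : Subset E} → Finite F → Dominant l A → Dominant l (A ∪ F)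
  Dominant-∪ finF (infA , finA) =
    (λ fin → infA (Finite-⊆ (λ _ → inj₁) fin)) ,
    Finite-⊆ (λ where x (inj₁ ax , c≢l) → inj₁ (ax , c≢l)
                      x (inj₂ fx , _) → inj₂ fx)
             (Finite-∪ finA finF)

  Dominant⇒col-bounded : {A : Subset E} → Dominant l A → ∃ λ c → ∀ x → A x → col x < c
  Dominant⇒col-bounded {A} (_ , finA) = suc (l ⊔ m) , λ x ax → s≤s (col≤ x ax)
    where
    m = proj₁ (finite⇒bounded col finA)
    col≤ : ∀ x → A x → col x ≤ l ⊔ m
    col≤ x ax with col x ≟ l
    ... | yes c≡l = ≤-trans (≤-reflexive c≡l) (m≤m⊔n l m)
    ... | no c≢l = ≤-trans (<⇒≤ (proj₂ (finite⇒bounded col finA) x (ax , c≢l))) (m≤n⊔m l m)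

  Dominant-unique : {l' : ℕ} {A B : Subset E} → A ⊆ B → Dominant l A → Dominant l' B → l ≡ l'
  Dominant-unique {l'} {A} {B} A⊆B (infA , finA) (_ , finB) with l ≟ l'
  ... | yes l≡l' = l≡l'
  ... | no l≢l' = ⊥-elim (infA (Finite-⊆ off-l-or-l' (Finite-∪ finA finB)))
    where
    off-l-or-l' : A ⊆ ((λ x → A x × col x ≢ l) ∪ (λ x → B x × col x ≢ l'))
    off-l-or-l' x ax with col x ≟ l
    ... | yes c≡l = inj₂ (A⊆B x ax , λ c≡l' → l≢l' (trans (sym c≡l) c≡l'))
    ... | no c≢l = inj₁ (ax , c≢l)

-- An equivalent description of 𝓛

-- L₁ A is definitionally ∀ n → Slack 0 n (A ↓ n).
Indep : Subset E → Set
Indep A = L₁ A × (∀ l → Dominant l A → EventualSlack (suc l) A)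

𝓛⇒Indep : {A : Subset E} → 𝓛 A → Indep A
𝓛⇒Indep (inj₁ (finA , L₁A)) = L₁A , λ _ (infA , _) → ⊥-elim (infA finA)
𝓛⇒Indep (inj₂ (inj₁ (_ , L₁A , undominated))) = L₁A , λ l dom → ⊥-elim (undominated l dom)
𝓛⇒Indep {A} (inj₂ (inj₂ (A₁ , l , X , L₁A₁ , domA₁ , X⊆A₁ , atLeastX , A≈A₁∖X))) =
  L₁-⊆ A⊆A₁ L₁A₁ , slack
  where
  A⊆A₁ : A ⊆ A₁
  A⊆A₁ x ax = proj₁ (proj₁ (A≈A₁∖X x) ax)
  X⊆A₁∖A : X ⊆ (A₁ ∖ A)
  X⊆A₁∖A x xx = X⊆A₁ x xx , λ ax → proj₂ (proj₁ (A≈A₁∖X x) ax) xx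
  slack : ∀ l' → Dominant l' A → EventualSlack (suc l') A
  slack l' domA with Dominant-unique A⊆A₁ domA domA₁
  ... | refl = EventualSlack-∖ (L₁⇒EventualSlack L₁A₁) A⊆A₁ (AtLeast-⊆ X⊆A₁∖A atLeastX)

Dominant-slack⇒𝓛 : {l : ℕ} {A : Subset E} → L₁ A → Dominant l A → EventualSlack (suc l) A → 𝓛 A
Dominant-slack⇒𝓛 {l} {A} L₁A domA (R , slack) =
  inj₂ (inj₂ (A ∪ (_∈ Y) , l , (_∈ Y) , L₁A∪Y , Dominant-∪ (Finite-list Y) domA , (λ _ → inj₂) ,
               AtLeast-segment (All.tabulate (λ y → y)) , A≈A∪Y∖Y))
  where
  c = proj₁ (Dominant⇒col-bounded domA)
  -- l + 1 cells in a column right of A, in the rows from R on, where A has slack l + 1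
  Y = segment c R (suc l)
  Y∉A : ∀ {x} → x ∈ Y → ¬ A x
  Y∉A x∈Y ax = <-irrefl (proj₁ (∈-segment⁻ x∈Y)) (proj₂ (Dominant⇒col-bounded domA) _ ax)
  L₁A∪Y : L₁ (A ∪ (_∈ Y))
  L₁A∪Y n with R ≤? n
  ... | yes R≤n = Slack-⊆ (λ { x (inj₁ ax , r) → inj₁ (ax , r) ; x (inj₂ x∈Y , _) → inj₂ x∈Y })
                          (Slack-insert Y (Slack-≤ (≤-reflexive (trans (+-identityʳ _) length-segment)) (slack n R≤n)))
  ... | no R≰n = Slack-⊆ below-R (L₁A n)
    where
    below-R : ((A ∪ (_∈ Y)) ↓ n) ⊆ (A ↓ n)
    below-R x (inj₁ ax , r) = ax , r
    below-R x (inj₂ x∈Y , r) = ⊥-elim (R≰n (≤-trans (proj₁ (proj₂ (∈-segment⁻ x∈Y))) (<⇒≤ r)))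
  A≈A∪Y∖Y : ∀ x → (A x → ((A ∪ (_∈ Y)) ∖ (_∈ Y)) x) × (((A ∪ (_∈ Y)) ∖ (_∈ Y)) x → A x)
  A≈A∪Y∖Y x = (λ ax → inj₁ ax , λ x∈Y → Y∉A x∈Y ax) , λ where
    (inj₁ ax , _) → ax
    (inj₂ x∈Y , x∉Y) → ⊥-elim (x∉Y x∈Y)

module _ {A : Subset E} where

  L₁-insert : {b : E} → L₁ A → (∀ n → row b < n → ¬ Tight A n) → L₁ (A ∪ ｛ b ｝)
  L₁-insert {b} L₁A loose n with row b <? n
  ... | yes b<n = Slack-⊆ (λ { x (inj₁ ax , r) → inj₁ (ax , r) ; x (inj₂ refl , _) → inj₂ (here refl) })
                          (Slack-insert (b ∷ []) (¬AtLeast⇒Slack1 (loose n b<n)))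
  ... | no b≮n = Slack-⊆ (λ { x (inj₁ ax , r) → ax , r ; x (inj₂ refl , r) → ⊥-elim (b≮n r) }) (L₁A n)

  L₁-insert⇒¬Tight : {y : E} {n : ℕ} → L₁ (A ∪ ｛ y ｝) → ¬ A y → row y < n → ¬ Tight A n
  L₁-insert⇒¬Tight {y} {n} L₁Ay y∉A y<n tight =
    1+n≰n (AtLeast-Slack tight (Slack-∖ (L₁Ay n) (↓-⊆ (λ _ → inj₁)) ([] ∷ [])
                                          (((inj₂ refl , y<n) , λ (ay , _) → y∉A ay) ∷ [])))

  Indep-exchange : {y b : E} → Indep A → Indep (A ∪ ｛ y ｝) → ¬ A y →
                   (∀ n → row b < n → ¬ Tight A n) → Indep (A ∪ ｛ b ｝)
  Indep-exchange {y} (L₁A , _) (_ , slackA∪y) y∉A loose = L₁-insert L₁A loose , λ l domA∪b →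
    let domA = Dominant-⊆ (λ _ → inj₁) (Infinite-∪⁻ Finite-｛｝ (proj₁ domA∪b)) domA∪b
        y∈A∪y∖A = y ∷ [] , [] ∷ [] , (inj₂ refl , y∉A) ∷ [] , ≤-refl
    in EventualSlack-insert (EventualSlack-∖ (slackA∪y l (Dominant-∪ Finite-｛｝ domA)) (λ _ → inj₁) y∈A∪y∖A)

Fin-ify⇒L₁ : {F : Subset E} → Fin-ify 𝓛 F → L₁ F
Fin-ify⇒L₁ finIndep n zs u zs⊆ =
  proj₁ (𝓛⇒Indep (finIndep (_∈ zs) (λ _ x∈ → proj₁ (All.lookup zs⊆ x∈)) (Finite-list zs)))
    n zs u (All.tabulate λ x∈ → x∈ , proj₂ (All.lookup zs⊆ x∈))

-- F with any l + 1 of its cells deleted is in 𝓛 by clause (iii).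
Base-misses≤ : {l : ℕ} {F B : Subset E} → L₁ F → Dominant l F → Base 𝓛 B → B ⊆ F → AtMost (suc l) (F ∖ B)
Base-misses≤ _ _ _ _ [] _ _ = z≤n
Base-misses≤ {l} {F} {B} L₁F domF (_ , maxB) B⊆F (y ∷ ys) (y∉ys ∷ uys) ((fy , y∉B) ∷ ys⊆F∖B)
  with suc l ≤? length ys
... | no l≮ys = ≰⇒> l≮ys
... | yes l<ys = ⊥-elim (y∉B (maxB (F ∖ (_∈ ys)) 𝓛F∖ys B⊆F∖ys y (fy , λ y∈ys → All.lookup y∉ys y∈ys refl)))
  where
  𝓛F∖ys : 𝓛 (F ∖ (_∈ ys))
  𝓛F∖ys = inj₂ (inj₂ (F , l , (_∈ ys) , L₁F , domF , (λ _ x∈ → proj₁ (All.lookup ys⊆F∖B x∈)) ,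
                       (ys , uys , All.tabulate (λ x∈ → x∈) , l<ys) , λ _ → (λ p → p) , (λ p → p)))
  B⊆F∖ys : B ⊆ (F ∖ (_∈ ys))
  B⊆F∖ys x bx = B⊆F x bx , λ x∈ys → proj₂ (All.lookup ys⊆F∖B x∈ys) bx

column : ℕ → Subset E
column c x = col x ≡ c

columnTail : ℕ → Subset E
columnTail c = column c ∖ (_∈ segment c 0 (suc c))

module _ {c : ℕ} where

  column-tight : ∀ k → Tight (column c) k
  column-tight k = AtLeast-segment (All.tabulate λ x∈ → let c≡ , _ , r = ∈-segment⁻ x∈ in c≡ , r)

  L₁-column : L₁ (column c)
  L₁-column n zs u zs⊆ =
    subst (length zs ≤_) length-segment
          (Unique⊆⇒length≤ _≟E_ u λ x∈ → let c≡ , r = All.lookup zs⊆ x∈ in ∈-segment⁺ c≡ r)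

  column-L₁-maximal : {T : Subset E} → L₁ T → column c ⊆ T → T ⊆ column c
  column-L₁-maximal {T} L₁T column⊆T x tx with col x ≟ c
  ... | yes c≡ = c≡
  ... | no c≢ = ⊥-elim (1+n≰n (AtLeast-Slack (column-tight m)
                          (Slack-∖ (L₁T m) (↓-⊆ column⊆T) ([] ∷ []) (((tx , ≤-refl) , λ (c≡ , _) → c≢ c≡) ∷ []))))
    where
    m = suc (row x)

  column-baseFin : BaseFin 𝓛 (column c)
  column-baseFin = (λ G G⊆column finG → inj₁ (finG , L₁-⊆ G⊆column L₁-column)) ,
                   λ T finIndepT → column-L₁-maximal (Fin-ify⇒L₁ finIndepT)

  segment-⊆-columnTail : ∀ {k x} → x ∈ segment c (suc c) k → columnTail c x
  segment-⊆-columnTail x∈ = let c≡ , c<r , _ = ∈-segment⁻ x∈ in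
    c≡ , λ x∈₀ → <⇒≱ (proj₂ (proj₂ (∈-segment⁻ x∈₀))) c<r

  Infinite-columnTail : Infinite (columnTail c)
  Infinite-columnTail = rows-unbounded⇒Infinite λ r →
    (c , suc c + r) , segment-⊆-columnTail {k = suc r} (∈-map⁺ _ (∈-upTo⁺ (n<1+n r))) , m≤n+m r (suc c)

  column-dominant : Dominant c (column c)
  column-dominant =
    (λ fin → Infinite-columnTail (Finite-⊆ (λ _ → proj₁) fin)) , [] , λ _ (c≡ , c≢) → ⊥-elim (c≢ c≡)

  columnTail-slack≤ : {k : ℕ} → EventualSlack k (columnTail c) → k ≤ suc c
  columnTail-slack≤ {k} (R , slack) =
    +-cancelʳ-≤ R k (suc c) (AtLeast-Slack tight (slack (suc c + R) (m≤n+m R (suc c))))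
    where
    tight : AtLeast R (columnTail c ↓ (suc c + R))
    tight = AtLeast-segment (All.tabulate λ x∈ → segment-⊆-columnTail x∈ , proj₂ (proj₂ (∈-segment⁻ x∈)))

-- The matroid axioms

L₁-Saturated : Subset E → Subset E → Set
L₁-Saturated X S = ∀ z → X z → L₁ (S ∪ ｛ z ｝) → S z

Extension : Subset E → Subset E → ℕ → Set
Extension X S k = Σ (List E) λ ts → Unique ts × k ≤ length ts × All (X ∖ S) ts × Indep (S ∪ (_∈ ts))

module _ (lem : LEM) where

  byContradiction : {P : Set} → ¬ ¬ P → P
  byContradiction {P} ¬¬p with lem P
  ... | inj₁ p = p
  ... | inj₂ ¬p = ⊥-elim (¬¬p ¬p)

  AtMost⇒Finite : {k : ℕ} {P : Subset E} → AtMost k P → Finite P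
  AtMost⇒Finite {zero} atMost = [] , λ x px → ⊥-elim (1+n≰n (atMost (x ∷ []) ([] ∷ []) (px ∷ [])))
  AtMost⇒Finite {suc k} {P} atMost with lem (∃ P)
  ... | inj₂ P-empty = [] , λ x px → ⊥-elim (P-empty (x , px))
  ... | inj₁ (x , px) = x ∷ proj₁ finRest , cover
    where
    atMostRest : AtMost k (P ∖ ｛ x ｝)
    atMostRest zs u zs⊆ =
      ≤-pred (atMost (x ∷ zs) (All.map (λ (_ , z≢x) x≡z → z≢x (sym x≡z)) zs⊆ ∷ u) (px ∷ All.map proj₁ zs⊆))
    finRest = AtMost⇒Finite atMostRest
    cover : ∀ z → P z → z ∈ x ∷ proj₁ finRest
    cover z pz with z ≟E x
    ... | yes z≡x = here z≡x
    ... | no z≢x = there (proj₂ finRest z (pz , z≢x))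

  Infinite⇒AtLeast : {P : Subset E} → Infinite P → ∀ k → AtLeast k P
  Infinite⇒AtLeast infP zero = [] , [] , [] , z≤n
  Infinite⇒AtLeast {P} infP (suc k) with Infinite⇒AtLeast infP k
  ... | xs , u , pxs , k≤ with lem (∃ λ x → P x × x ∉ xs)
  ... | inj₁ (x , px , x∉xs) = x ∷ xs , All.¬Any⇒All¬ xs x∉xs ∷ u , px ∷ pxs , s≤s k≤
  ... | inj₂ xs-covers = ⊥-elim (infP (xs , λ x px → byContradiction λ x∉xs → xs-covers (x , px , x∉xs)))

  Infinite-∖ : {P Q : Subset E} → Infinite P → Finite Q → Infinite (P ∖ Q)
  Infinite-∖ {P} {Q} infP finQ finP∖Q = infP (Finite-⊆ split (Finite-∪ finP∖Q finQ))
    where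
    split : P ⊆ ((P ∖ Q) ∪ Q)
    split x px with lem (Q x)
    ... | inj₁ qx = inj₂ qx
    ... | inj₂ ¬qx = inj₁ (px , ¬qx)

  greatest≤ : (Q : ℕ → Set) → Q 0 → ∀ m → ∃ λ n → n ≤ m × Q n × (∀ k → n < k → k ≤ m → ¬ Q k)
  greatest≤ Q q₀ zero = 0 , z≤n , q₀ , λ k 0<k k≤0 → ⊥-elim (<⇒≱ 0<k k≤0)
  greatest≤ Q q₀ (suc m) with lem (Q (suc m))
  ... | inj₁ q = suc m , ≤-refl , q , λ k m<k k≤m → ⊥-elim (<⇒≱ m<k k≤m)
  ... | inj₂ ¬q with greatest≤ Q q₀ m
  ...   | n , n≤m , qn , none-above = n , m≤n⇒m≤1+n n≤m , qn , none-above′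
    where
    none-above′ : ∀ k → n < k → k ≤ suc m → ¬ Q k
    none-above′ k n<k k≤1+m with m≤n⇒m<n∨m≡n k≤1+m
    ... | inj₁ k<1+m = none-above k n<k (≤-pred k<1+m)
    ... | inj₂ refl = ¬q

  Indep⇒𝓛 : {A : Subset E} → Indep A → 𝓛 A
  Indep⇒𝓛 {A} (L₁A , slack) with lem (∃ λ l → Dominant l A) | lem (Finite A)
  ... | inj₁ (l , domA) | _ = Dominant-slack⇒𝓛 L₁A domA (slack l domA)
  ... | inj₂ _ | inj₁ finA = inj₁ (finA , L₁A)
  ... | inj₂ undominated | inj₂ infA = inj₂ (inj₁ (infA , L₁A , λ l domA → undominated (l , domA)))

  Indep-⊆ : {A B : Subset E} → A ⊆ B → Indep B → Indep A
  Indep-⊆ {A} {B} A⊆B (L₁B , slackB) = L₁-⊆ A⊆B L₁B , slackA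
    where
    slackA : ∀ l → Dominant l A → EventualSlack (suc l) A
    slackA l domA with lem (Dominant l B)
    ... | inj₁ domB = EventualSlack-⊆ A⊆B (slackB l domB)
    ... | inj₂ ¬domB = EventualSlack-∖ (L₁⇒EventualSlack L₁B) A⊆B
                         (AtLeast-⊆ (λ x ((bx , c≢l) , ¬ax) → bx , λ ax → ¬ax (ax , c≢l))
                                    (Infinite⇒AtLeast (Infinite-∖ infB∖l (proj₂ domA)) (suc l)))
      where
      infB∖l : Infinite (λ x → B x × col x ≢ l)
      infB∖l finB∖l = ¬domB ((λ finB → proj₁ domA (Finite-⊆ A⊆B finB)) , finB∖l)

  Indep-extensible : {A : Subset E} → Indep A → ¬ Maximal 𝓛 A → ∃ λ y → ¬ A y × Indep (A ∪ ｛ y ｝)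
  Indep-extensible {A} IA ¬maxA with lem (∃ λ y → ¬ A y × Indep (A ∪ ｛ y ｝))
  ... | inj₁ extension = extension
  ... | inj₂ none = ⊥-elim (¬maxA (Indep⇒𝓛 IA , maxA))
    where
    maxA : ∀ T → 𝓛 T → A ⊆ T → T ⊆ A
    maxA T 𝓛T A⊆T x tx = byContradiction λ x∉A → none (x , x∉A , Indep-⊆ (∪｛｝-⊆ A⊆T tx) (𝓛⇒Indep 𝓛T))

  -- Cells of Q off column l, outside P and from row n₀ on are infinitely many; adding l + 1
  -- of them to P keeps it dominated by Q, hence eventually in 𝓛₁.
  Dominated-slack : {l n₀ : ℕ} {P Q : Subset E} → L₁ Q → Dominated n₀ P Q → Dominant l P → ¬ Dominant l Q →
                    EventualSlack (suc l) P
  Dominated-slack {l} {n₀} {P} {Q} L₁Q dom@(lowP , _ , highP⊆Q) domP ¬domQ =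
    EventualSlack-∖ (n₀ , λ n n₀≤n → Slack-transfer (Dominated-∪ dom F⊆Q F-high) n₀≤n (L₁Q n)) (λ _ → inj₁)
                    (AtLeast-⊆ F⊆P∪F∖P (Infinite⇒AtLeast infF (suc l)))
    where
    F : Subset E
    F x = ((Q x × col x ≢ l) × ¬ (P x × col x ≢ l)) × ¬ (Q ↓ n₀) x
    F⊆Q : F ⊆ Q
    F⊆Q x (((qx , _) , _) , _) = qx
    F-high : ∀ x → F x → n₀ ≤ row x
    F-high x (((qx , _) , _) , ¬low) = ≮⇒≥ λ r → ¬low (qx , r)
    F⊆P∪F∖P : F ⊆ ((P ∪ F) ∖ P)
    F⊆P∪F∖P x fx@(((_ , c≢l) , ¬p) , _) = inj₂ fx , λ px → ¬p (px , c≢l)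
    P⊆lowP∪Q : P ⊆ ((P ↓ n₀) ∪ Q)
    P⊆lowP∪Q x px with row x <? n₀
    ... | yes r = inj₁ (px , r)
    ... | no ¬r = inj₂ (highP⊆Q x px (≮⇒≥ ¬r))
    infQ : Infinite Q
    infQ finQ = proj₁ domP (Finite-⊆ P⊆lowP∪Q (Finite-∪ (AtMost⇒Finite lowP) finQ))
    infF : Infinite F
    infF = Infinite-∖ (Infinite-∖ (λ fin → ¬domQ (infQ , fin)) (proj₂ domP)) (AtMost⇒Finite (L₁Q n₀))

  Indep-dominated : {n₀ : ℕ} {B P Q : Subset E} → L₁ B → Indep Q → Dominated n₀ P Q → (P ↓ n₀) ⊆ B → Indep P
  Indep-dominated {n₀} {B} {P} {Q} L₁B (L₁Q , slackQ) dom lowP⊆B = L₁P , slackP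
    where
    L₁P : L₁ P
    L₁P n with n₀ ≤? n
    ... | yes n₀≤n = Slack-transfer dom n₀≤n (L₁Q n)
    ... | no n₀≰n = Slack-⊆ (λ x (px , r) → lowP⊆B x (px , <-trans r (≰⇒> n₀≰n)) , r) (L₁B n)
    slackP : ∀ l → Dominant l P → EventualSlack (suc l) P
    slackP l domP with lem (Dominant l Q)
    ... | inj₁ domQ = EventualSlack-transfer dom (slackQ l domQ)
    ... | inj₂ ¬domQ = Dominated-slack L₁Q dom domP ¬domQ

  last-tight-level : {A : Subset E} {y : E} → L₁ (A ∪ ｛ y ｝) → ¬ A y →
                     ∃ λ n₀ → n₀ ≤ row y × Tight A n₀ × (∀ n → n₀ < n → ¬ Tight A n)
  last-tight-level {A} {y} L₁A∪y y∉A with greatest≤ (Tight A) ([] , [] , [] , z≤n) (row y)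
  ... | n₀ , n₀≤y , tightA , none-up-to-y = n₀ , n₀≤y , tightA , loose
    where
    loose : ∀ n → n₀ < n → ¬ Tight A n
    loose n n₀<n with n ≤? row y
    ... | yes n≤y = none-up-to-y n n₀<n n≤y
    ... | no n≰y = L₁-insert⇒¬Tight L₁A∪y y∉A (≰⇒> n≰y)

  Indep-augment : {A B : Subset E} → Maximal 𝓛 B → Indep A → ¬ Maximal 𝓛 A →
                  ∃ λ b → B b × ¬ A b × Indep (A ∪ ｛ b ｝)
  Indep-augment {A} {B} (𝓛B , maxB) IA ¬maxA with Indep-extensible IA ¬maxA
  ... | y , y∉A , IA∪y with last-tight-level (proj₁ IA∪y) y∉A
  ... | n₀ , n₀≤y , tightA , loose with lem (∃ λ b → B b × n₀ ≤ row b × ¬ A b)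
  ... | inj₁ (b , bb , n₀≤b , b∉A) =
    b , bb , b∉A , Indep-exchange IA IA∪y y∉A λ n b<n → loose n (≤-<-trans n₀≤b b<n)
  ... | inj₂ no-b =
    ⊥-elim (y∉A (highB⊆A y (maxB (B ∪ ｛ y ｝) (Indep⇒𝓛 IB∪y) (λ _ → inj₁) y (inj₂ refl)) n₀≤y))
    where
    highB⊆A : ∀ x → B x → n₀ ≤ row x → A x
    highB⊆A x bx n₀≤x = byContradiction λ x∉A → no-b (x , bx , n₀≤x , x∉A)
    lowB∪y⊆B : ((B ∪ ｛ y ｝) ↓ n₀) ⊆ B
    lowB∪y⊆B x (inj₁ bx , _) = bx
    lowB∪y⊆B x (inj₂ refl , r) = ⊥-elim (<⇒≱ r n₀≤y)
    highB∪y⊆A∪y : ∀ x → (B ∪ ｛ y ｝) x → n₀ ≤ row x → (A ∪ ｛ y ｝) x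
    highB∪y⊆A∪y x (inj₁ bx) n₀≤x = inj₁ (highB⊆A x bx n₀≤x)
    highB∪y⊆A∪y x (inj₂ x≡y) _ = inj₂ x≡y
    L₁B = proj₁ (𝓛⇒Indep 𝓛B)
    IB∪y : Indep (B ∪ ｛ y ｝)
    IB∪y = Indep-dominated L₁B IA∪y
             (Slack-⊆ (λ x p → lowB∪y⊆B x p , proj₂ p) (L₁B n₀) , AtLeast-⊆ (↓-⊆ (λ _ → inj₁)) tightA ,
              highB∪y⊆A∪y)
             lowB∪y⊆B

  module Greedy (P : Subset E → Set) (P-⊆ : ∀ {A B} → A ⊆ B → P B → P A)
                {A X : Subset E} (PA : P A) (A⊆X : A ⊆ X) where

    stage : ℕ → Subset E
    stage zero = A
    stage (suc k) x = stage k x ⊎ ((X (cell k) × P (stage k ∪ ｛ cell k ｝)) × x ≡ cell k)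

    limit : Subset E
    limit x = ∃ λ k → stage k x

    P-stage : ∀ k → P (stage k)
    P-stage zero = PA
    P-stage (suc k) with lem (X (cell k) × P (stage k ∪ ｛ cell k ｝))
    ... | inj₁ (_ , P∪cell) = P-⊆ (λ { x (inj₁ sx) → inj₁ sx ; x (inj₂ (_ , x≡c)) → inj₂ x≡c }) P∪cell
    ... | inj₂ rejected =
      P-⊆ (λ { x (inj₁ sx) → sx ; x (inj₂ (accepted , _)) → ⊥-elim (rejected accepted) }) (P-stage k)

    stage⊆X : ∀ k → stage k ⊆ X
    stage⊆X zero = A⊆X
    stage⊆X (suc k) x (inj₁ sx) = stage⊆X k x sx
    stage⊆X (suc k) x (inj₂ ((xc , _) , refl)) = xc

    stage-mono : ∀ {j k} → j ≤ k → stage j ⊆ stage k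
    stage-mono {k = zero} z≤n x sx = sx
    stage-mono {k = suc k} j≤1+k x sx with m≤n⇒m<n∨m≡n j≤1+k
    ... | inj₁ j<1+k = inj₁ (stage-mono (≤-pred j<1+k) x sx)
    ... | inj₂ refl = sx

    limit-list : (zs : List E) → All limit zs → ∃ λ K → All (stage K) zs
    limit-list [] [] = 0 , []
    limit-list (z ∷ zs) ((k , sz) ∷ zs⊆) with limit-list zs zs⊆
    ... | K , zs⊆K = k ⊔ K , stage-mono (m≤m⊔n k K) z sz ∷ All.map (stage-mono (m≤n⊔m k K) _) zs⊆K

    limit-saturated : ∀ z → X z → P (limit ∪ ｛ z ｝) → limit z
    limit-saturated z xz P∪z with cell-surjective z
    ... | k , refl =
      suc k , inj₂ ((xz , P-⊆ (λ { x (inj₁ sx) → inj₁ (k , sx) ; x (inj₂ x≡c) → inj₂ x≡c }) P∪z) , refl)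

  L₁-saturated-extension : {A X : Subset E} → L₁ A → A ⊆ X →
                           Σ (Subset E) λ S → L₁ S × A ⊆ S × S ⊆ X × L₁-Saturated X S
  L₁-saturated-extension L₁A A⊆X =
    limit , L₁-limit , (λ x ax → 0 , ax) , (λ x (k , sx) → stage⊆X k x sx) , limit-saturated
    where
    open Greedy L₁ L₁-⊆ L₁A A⊆X
    L₁-limit : L₁ limit
    L₁-limit n zs u zs⊆ with limit-list zs (All.map proj₁ zs⊆)
    ... | K , zs⊆K = P-stage K n zs u (All.zipWith (λ (sx , (_ , r)) → sx , r) (zs⊆K , zs⊆))

  unsaturated⇒tight : {X S : Subset E} {z : E} → L₁ S → L₁-Saturated X S → X z → ¬ S z →
                      ∃ λ n → Tight S n × row z < n
  unsaturated⇒tight L₁S satS xz z∉S = byContradiction λ none →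
    z∉S (satS _ xz (L₁-insert L₁S λ n z<n tight → none (n , tight , z<n)))

  -- Below a common tight level of S₀ use tight-exchange; above it T ∖ S lies in S₀ ∖ S ⊆ Y.
  bounded-extension : {S₀ S X T : Subset E} (Y : List E) → L₁ S₀ → L₁-Saturated X S₀ →
                      (∀ x → S₀ x → x ∉ Y → S x) → L₁ T → S ⊆ T → T ⊆ X → AtMost (length Y) (T ∖ S)
  bounded-extension {S₀} {S} {X} {T} Y L₁S₀ satS₀ S₀∖Y⊆S L₁T S⊆T T⊆X zs u zs⊆T∖S = begin
    length zs                                               ≡⟨ sym (length-filter-∁ low? zs) ⟩
    length low + length high                                ≤⟨ +-mono-≤ low≤ high≤ ⟩
    length (filter low? Y) + length (filter (∁? low?) Y)   ≡⟨ length-filter-∁ low? Y ⟩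
    length Y                                                ∎
    where
    open ≤-Reasoning
    in-S₀-or-blocked : ∀ {z} → z ∈ zs → S₀ z ⊎ ∃ λ n → Tight S₀ n × row z < n
    in-S₀-or-blocked {z} z∈ with lem (S₀ z)
    ... | inj₁ s = inj₁ s
    ... | inj₂ z∉S₀ = inj₂ (unsaturated⇒tight L₁S₀ satS₀ (T⊆X z (proj₁ (All.lookup zs⊆T∖S z∈))) z∉S₀)
    level = common-level row ([] , [] , [] , z≤n) zs in-S₀-or-blocked
    n = proj₁ level
    low? : Decidable (λ x → row x < n)
    low? x = row x <? n
    low = filter low? zs
    high = filter (∁? low?) zs
    low≤ : length low ≤ length (filter low? Y)
    low≤ = tight-exchange Y (proj₁ (proj₂ level)) L₁T (λ _ → proj₁)
             (λ x s x∉Y → S⊆T x (S₀∖Y⊆S x s x∉Y) , λ (_ , x∉S) → x∉S (S₀∖Y⊆S x s x∉Y))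
             low (Unique.filter⁺ low? u)
             (All.tabulate λ x∈ → let x∈zs , r = ∈-filter⁻ low? {xs = zs} x∈ in All.lookup zs⊆T∖S x∈zs , r)
    high∈Y : ∀ {x} → x ∈ zs → ¬ row x < n → x ∈ Y
    high∈Y {x} x∈zs ¬r with proj₂ (proj₂ level) x∈zs | x ∈? Y
    ... | _ | yes x∈Y = x∈Y
    ... | inj₁ s | no x∉Y = ⊥-elim (proj₂ (All.lookup zs⊆T∖S x∈zs) (S₀∖Y⊆S x s x∉Y))
    ... | inj₂ r | no _ = ⊥-elim (¬r r)
    high≤ : length high ≤ length (filter (∁? low?) Y)
    high≤ = Unique⊆⇒length≤ _≟E_ (Unique.filter⁺ (∁? low?) u) λ x∈ →
      let x∈zs , ¬r = ∈-filter⁻ (∁? low?) {xs = zs} x∈ in ∈-filter⁺ (∁? low?) (high∈Y x∈zs ¬r) ¬r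

  independent-core : {A S₀ : Subset E} → Indep A → A ⊆ S₀ → L₁ S₀ →
                     Σ (Subset E) λ S → Σ (List E) λ Y →
                       Indep S × A ⊆ S × S ⊆ S₀ × (∀ x → S₀ x → x ∉ Y → S x)
  independent-core {A} {S₀} IA A⊆S₀ L₁S₀ with lem (∃ λ l → Dominant l S₀)
  ... | inj₂ undominated =
    S₀ , [] , (L₁S₀ , λ l dom → ⊥-elim (undominated (l , dom))) , A⊆S₀ , (λ _ s → s) , λ _ s _ → s
  ... | inj₁ (l , domS₀) with lem (AtLeast (suc l) (S₀ ∖ A))
  ... | inj₁ (Y , uY , Y⊆S₀∖A , l<Y) =
    S₀ ∖ (_∈ Y) , Y , 𝓛⇒Indep 𝓛S₀∖Y , (λ x ax → A⊆S₀ x ax , λ x∈Y → proj₂ (All.lookup Y⊆S₀∖A x∈Y) ax) ,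
    (λ _ → proj₁) , λ _ s x∉Y → s , x∉Y
    where
    𝓛S₀∖Y : 𝓛 (S₀ ∖ (_∈ Y))
    𝓛S₀∖Y = inj₂ (inj₂ (S₀ , l , (_∈ Y) , L₁S₀ , domS₀ , (λ _ x∈Y → proj₁ (All.lookup Y⊆S₀∖A x∈Y)) ,
                         (Y , uY , All.tabulate (λ x∈Y → x∈Y) , l<Y) , λ _ → (λ p → p) , (λ p → p)))
  ... | inj₂ few = A , proj₁ finS₀∖A , IA , (λ _ ax → ax) , A⊆S₀ ,
                   λ x s x∉Y → byContradiction λ x∉A → x∉Y (proj₂ finS₀∖A x (s , x∉A))
    where
    finS₀∖A : Finite (S₀ ∖ A)
    finS₀∖A = AtMost⇒Finite {l} (λ zs u zs⊆ → ≤-pred (¬AtLeast⇒Slack1 few zs u zs⊆))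

  Indep-maximal-extension : {A X : Subset E} → Indep A → A ⊆ X →
                            Σ (Subset E) λ S → Maximal (λ T → 𝓛 T × A ⊆ T × T ⊆ X) S
  Indep-maximal-extension {A} {X} IA A⊆X with L₁-saturated-extension (proj₁ IA) A⊆X
  ... | S₀ , L₁S₀ , A⊆S₀ , S₀⊆X , satS₀ with independent-core IA A⊆S₀ L₁S₀
  ... | S , Y , IS , A⊆S , S⊆S₀ , S₀∖Y⊆S
    with greatest≤ (Extension X S) ([] , [] , z≤n , [] , Indep-⊆ (λ { x (inj₁ sx) → sx }) IS) (length Y)
  ... | k , _ , (ts , uts , k≤ts , ts⊆X∖S , IS∪ts) , none-larger =
    S ∪ (_∈ ts) , (Indep⇒𝓛 IS∪ts , (λ x ax → inj₁ (A⊆S x ax)) , S∪ts⊆X) , maximal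
    where
    S∪ts⊆X : (S ∪ (_∈ ts)) ⊆ X
    S∪ts⊆X x (inj₁ sx) = S₀⊆X x (S⊆S₀ x sx)
    S∪ts⊆X x (inj₂ x∈ts) = proj₁ (All.lookup ts⊆X∖S x∈ts)
    maximal : ∀ T → 𝓛 T × A ⊆ T × T ⊆ X → (S ∪ (_∈ ts)) ⊆ T → T ⊆ (S ∪ (_∈ ts))
    maximal T (𝓛T , _ , T⊆X) S∪ts⊆T x tx = byContradiction λ x∉S∪ts →
      let ts′ = x ∷ ts
          uts′ = All.¬Any⇒All¬ ts (λ x∈ts → x∉S∪ts (inj₂ x∈ts)) ∷ uts
          ts′⊆X∖S = (T⊆X x tx , λ sx → x∉S∪ts (inj₁ sx)) ∷ ts⊆X∖S
          S∪ts′⊆T : (S ∪ (_∈ ts′)) ⊆ T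
          S∪ts′⊆T = λ { y (inj₁ sy) → S∪ts⊆T y (inj₁ sy)
                      ; y (inj₂ (here refl)) → tx
                      ; y (inj₂ (there y∈ts)) → S∪ts⊆T y (inj₂ y∈ts) }
          ts′⊆T∖S = All.tabulate λ y∈ → S∪ts′⊆T _ (inj₂ y∈) , proj₂ (All.lookup ts′⊆X∖S y∈)
          ts′≤Y = bounded-extension Y L₁S₀ satS₀ S₀∖Y⊆S (proj₁ (𝓛⇒Indep 𝓛T)) (λ y sy → S∪ts⊆T y (inj₁ sy)) T⊆X
                    ts′ uts′ ts′⊆T∖S
      in none-larger (suc k) ≤-refl (≤-trans (s≤s k≤ts) ts′≤Y)
           (ts′ , uts′ , s≤s k≤ts , ts′⊆X∖S , Indep-⊆ S∪ts′⊆T (𝓛⇒Indep 𝓛T))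

  𝓛-isMatroid : IsMatroid 𝓛
  𝓛-isMatroid = record
    { I1 = inj₁ (([] , λ _ ()) , L₁-∅)
    ; I2 = λ A B 𝓛B A⊆B → Indep⇒𝓛 (Indep-⊆ A⊆B (𝓛⇒Indep 𝓛B))
    ; I3 = λ A B maxB 𝓛A ¬maxA → let b , bb , b∉A , IA∪b = Indep-augment maxB (𝓛⇒Indep 𝓛A) ¬maxA
                                 in b , bb , b∉A , Indep⇒𝓛 IA∪b
    ; I4 = λ A X 𝓛A A⊆X → Indep-maximal-extension (𝓛⇒Indep 𝓛A) A⊆X
    }

  𝓛-nearlyFinitary : NearlyFinitary 𝓛
  𝓛-nearlyFinitary F B (finIndepF , _) baseB B⊆F with lem (∃ λ l → Dominant l F)
  ... | inj₁ (l , domF) = AtMost⇒Finite (Base-misses≤ (Fin-ify⇒L₁ finIndepF) domF baseB B⊆F)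
  ... | inj₂ undominated = [] , λ x (fx , x∉B) → ⊥-elim (x∉B (proj₂ baseB F 𝓛F B⊆F x fx))
    where
    𝓛F : 𝓛 F
    𝓛F = Indep⇒𝓛 (Fin-ify⇒L₁ finIndepF , λ l domF → ⊥-elim (undominated (l , domF)))

  columnTail-base : ∀ c → Base 𝓛 (columnTail c)
  columnTail-base c = 𝓛columnTail , maximal
    where
    𝓛columnTail : 𝓛 (columnTail c)
    𝓛columnTail = inj₂ (inj₂ (column c , c , (_∈ segment c 0 (suc c)) , L₁-column , column-dominant ,
                               (λ _ x∈ → proj₁ (∈-segment⁻ x∈)) , AtLeast-segment (All.tabulate (λ x∈ → x∈)) ,
                               λ _ → (λ p → p) , (λ p → p)))
    maximal : ∀ T → 𝓛 T → columnTail c ⊆ T → T ⊆ columnTail c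
    maximal T 𝓛T tail⊆T x tx = byContradiction λ x∉tail →
      m+1+n≰m (suc c) (columnTail-slack≤
        (EventualSlack-∖ (slackT c domT) tail⊆T (x ∷ [] , [] ∷ [] , (tx , x∉tail) ∷ [] , ≤-refl)))
      where
      L₁T = proj₁ (𝓛⇒Indep 𝓛T)
      slackT = proj₂ (𝓛⇒Indep 𝓛T)
      few : AtMost (suc c) (T ∖ columnTail c)
      few ws u ws⊆ = columnTail-slack≤ (EventualSlack-∖ (L₁⇒EventualSlack L₁T) tail⊆T (ws , u , ws⊆ , ≤-refl))
      domT : Dominant c T
      domT = (λ finT → Infinite-columnTail (Finite-⊆ tail⊆T finT)) ,
             Finite-⊆ (λ x (tx , c≢) → tx , λ (c≡ , _) → c≢ c≡) (AtMost⇒Finite few)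

  𝓛-not-KNearlyFinitary : ∀ k → ¬ KNearlyFinitary k 𝓛
  𝓛-not-KNearlyFinitary k kNF = 1+n≰n (subst (_≤ k) length-segment
    (kNF (column k) (columnTail k) column-baseFin (columnTail-base k) (λ _ → proj₁)
         (segment k 0 (suc k)) segment-unique (All.tabulate λ x∈ → proj₁ (∈-segment⁻ x∈) , λ (_ , x∉) → x∉ x∈)))

mainTheorem1 : LEM →
    IsMatroid 𝓛 × NearlyFinitary 𝓛 × ((n : ℕ) → 1 ≤ n → ¬ KNearlyFinitary n 𝓛)
mainTheorem1 lem = 𝓛-isMatroid lem , 𝓛-nearlyFinitary lem , λ n _ → 𝓛-not-KNearlyFinitary lem n
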